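{- Let $l_1\ge0$, $l_2\ge0$, $l_3\ge3$ be integers with $7l_3\ge4(l_1+l_2)+17$ and $l_1(l_3-1)+l_2>3$. Let $\sigma$ be the substitution on $\{0,1\}$ given by $1\mapsto 1\,0^{l_1}\,1\,0^{l_2}$, $0\mapsto 0^{l_3}$, let $\mathbf{c}=\sigma^\infty(1)$, and let $S=\theta(\mathbf{c})=\{S_0<S_1<\cdots\}$. Then for each $0\le j\le3$, the sequence $(S_{4n+j}\bmod 2)_{n\ge0}$ is either periodic or equal to the Thue--Morse sequence up to a coding.
   Context: $0^{l}$ denotes a block of $l$ zeros. A set $S$ of positive integers is sum-free if there are no $x,y,z\in S$ ($x,y$ not necessarily distinct) with $x+y=z$. Cameron's bijection $\theta$: given a zero-one sequence $\mathbf{w}$, examine $n=1,2,3,\dots$ in order; if $n=x+y$ for some $x,y$ already placed in $S$, label $n$ by $\ast$ and $n\notin S$; otherwise read the next unread symbol of $\mathbf{w}$ and put $n\in S$ iff it is $1$. Then $\theta(\mathbf{w})=S$, listed increasingly. The Thue--Morse sequence is $(t_n)_{n\ge0}$ with $t_n$ the sum of the binary digits of $n$ modulo $2$; "up to a coding" means after applying a letter-to-letter map $\{0,1\}\to\{0,1\}$ (e.g. exchanging $0$ and $1$). -}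

module Defs where

open import Data.Nat using (ℕ; zero; suc; _+_; _*_; _≤_; _<_; _%_; _/_)
open import Data.Nat.Properties using (_≟_)
open import Data.Bool using (Bool; true; false; if_then_else_)
open import Data.List using (List; []; _∷_; _++_; replicate; concatMap)
open import Data.List.Relation.Unary.Any using (any?)
open import Data.List.Membership.Propositional using (_∈_)
open import Data.Product using (_×_; _,_; proj₁; ∃)
open import Relation.Nullary.Decidable using (⌊_⌋)
open import Relation.Binary.PropositionalEquality using (_≡_)
open import Function.Bundles using (_⇔_)

σ : ℕ → ℕ → ℕ → Bool → List Bool
σ l₁ l₂ l₃ true  = true ∷ replicate l₁ false ++ true ∷ replicate l₂ false
σ l₁ l₂ l₃ false = replicate l₃ false

σ^ : ℕ → ℕ → ℕ → ℕ → List Bool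
σ^ l₁ l₂ l₃ zero    = true ∷ []
σ^ l₁ l₂ l₃ (suc k) = concatMap (σ l₁ l₂ l₃) (σ^ l₁ l₂ l₃ k)

-- n-th entry of a list (default false if out of range)
nth : List Bool → ℕ → Bool
nth []       _       = false
nth (b ∷ bs) zero    = b
nth (b ∷ bs) (suc n) = nth bs n

-- σ^∞(1): its n-th letter is the n-th letter of σ^(n+1)(1)
-- (σ^k(1) is a prefix of σ^(k+1)(1) and has length ≥ 2^k ≥ k+1)
σ∞ : ℕ → ℕ → ℕ → ℕ → Bool
σ∞ l₁ l₂ l₃ n = nth (σ^ l₁ l₂ l₃ (suc n)) n

isSum : List ℕ → ℕ → Bool
isSum S m = ⌊ any? (λ x → any? (λ y → x + y ≟ m) S) S ⌋

-- Cameron's procedure: state after examining 1, …, n :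
-- (elements placed in S so far, number of symbols of w read so far)
θstate : (ℕ → Bool) → ℕ → List ℕ × ℕ
θstate w zero = [] , zero
θstate w (suc n) with θstate w n
... | S , k =
  if isSum S (suc n) then (S , k)
  else (if w k then (suc n ∷ S , suc k) else (S , suc k))

_∈θ_ : ℕ → (ℕ → Bool) → Set
m ∈θ w = m ∈ proj₁ (θstate w m)

Enumerates : (ℕ → ℕ) → (ℕ → Set) → Set
Enumerates s P = (∀ k → s k < s (suc k)) × (∀ m → P m ⇔ ∃ (λ k → s k ≡ m))

-- sum of binary digits of n (fuel-driven; fuel n suffices)
digitSumF : ℕ → ℕ → ℕ
digitSumF zero    n = zero
digitSumF (suc f) n = n % 2 + digitSumF f (n / 2)

digitSum : ℕ → ℕ
digitSum n = digitSumF n n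

thueMorse : ℕ → ℕ
thueMorse n = digitSum n % 2

Periodic : (ℕ → ℕ) → Set
Periodic a = ∃ (λ p → 0 < p × (∀ n → a (n + p) ≡ a n))

ThueMorseUpToCoding : (ℕ → ℕ) → Set
ThueMorseUpToCoding a =
  ∃ (λ (f : ℕ → ℕ) → (f 0 ≤ 1) × (f 1 ≤ 1) × (∀ n → a n ≡ f (thueMorse n)))

-- Let d i be the position of the second copy of σ^i(1) in σ^(i+1)(1) = σ^i(1) 0^(l₁l₃^i) σ^i(1) 0^(l₂l₃^i);
-- then the ones of c = σ^∞(1) sit exactly at the sums Σ nᵢ d i over binary expansions n = Σ nᵢ 2^i.
-- Put g i = 3^i + d i. Since g at least triples at each step, the sums of two elements of
-- A = {1 + Σ nᵢ g i} up to 2 g i + reach i (reach i = 2 + 2 Σ_{j<i} g j) form three disjoint translates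
-- of those up to reach i, so exactly 3^i numbers up to g i are such sums, and the number of non-sums
-- up to Σ nᵢ g i is Σ nᵢ (g i − 3^i) = Σ nᵢ d i. Following Cameron's procedure step by step, the
-- letter read at a non-sum n is therefore 1 exactly when n ∈ A, so θ(c) = A and S_k = 1 + Σ kᵢ g i.
-- Every g (i + 2) has the parity of 1 + l₂l₃, hence S_(4n+j) ≡ const + s₂(n)(1 + l₂l₃) (mod 2), which is
-- constant or a coding of the Thue–Morse sequence.

module Submission where

open import Defs
open import Data.Nat using (ℕ; zero; suc; _+_; _*_; _^_; _∸_; _≤_; _<_; z≤n; s≤s; _%_; _/_)
open import Data.Nat.Properties
open import Data.Nat.DivMod
open import Data.Nat.Divisibility using (divides-refl)
open import Data.Nat.Tactic.RingSolver using (solve-∀)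
open import Data.Bool using (Bool; true; false; if_then_else_)
open import Data.Bool.Properties using (not-¬)
open import Data.Empty using (⊥-elim)
open import Data.List using (List; []; _∷_; _++_; replicate; concatMap; length)
open import Data.List.Properties using (++-assoc; ++-identityʳ; length-++; length-replicate; concatMap-++)
open import Data.List.Relation.Unary.Any using (Any; here; there; any?)
open import Data.List.Membership.Propositional using (_∈_; find; lose)
open import Data.Product using (_×_; _,_; proj₁; proj₂; ∃; ∃₂; map₁; map₂)
open import Data.Sum using (_⊎_; inj₁; inj₂)
import Data.Sum as Sum
open import Function using (_∘_)
open import Function.Bundles using (Equivalence; _⇔_; mk⇔)
open import Level using (0ℓ)
open import Relation.Binary.Bundles using (Setoid)
open import Relation.Binary.Definitions using (tri<; tri≈; tri>)
open import Relation.Binary.PropositionalEquality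
import Relation.Binary.Reasoning.Setoid as ≈-Reasoning
open import Relation.Nullary using (¬_; Dec; yes; no)

Bit : ℕ → Set
Bit b = b ≤ 1

bit+double%2 : ∀ {b} m → Bit b → (b + m * 2) % 2 ≡ b
bit+double%2 {b} m b≤1 = trans ([m+kn]%n≡m%n b m 2) (m<n⇒m%n≡m (s≤s b≤1))

bit+double/2 : ∀ {b} m → Bit b → (b + m * 2) / 2 ≡ m
bit+double/2 {b} m b≤1 = begin
  (b + m * 2) / 2   ≡⟨ +-distrib-/-∣ʳ b (divides-refl m) ⟩
  b / 2 + m * 2 / 2 ≡⟨ cong₂ _+_ (m<n⇒m/n≡0 (s≤s b≤1)) (m*n/n≡m m 2) ⟩
  m                 ∎
  where open ≡-Reasoning

binary : ∀ k → ∃₂ λ b m → Bit b × k ≡ b + m * 2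
binary k = k % 2 , k / 2 , ≤-pred (m%n<n k 2) , m≡m%n+[m/n]*n k 2

half-<-2^ : ∀ {b} m i → Bit b → b + m * 2 < 2 ^ suc i → m < 2 ^ i
half-<-2^ {b} m i _ lt = *-cancelʳ-< 2 m (2 ^ i) (begin-strict
  m * 2         <⟨ s≤s (m≤n+m (m * 2) b) ⟩
  suc b + m * 2 ≤⟨ lt ⟩
  2 ^ suc i     ≡⟨ *-comm 2 (2 ^ i) ⟩
  2 ^ i * 2     ∎)
  where open ≤-Reasoning

<-2^suc : ∀ i k → k < 2 ^ suc i → k < 2 ^ i ⊎ ∃ λ k′ → k′ < 2 ^ i × k ≡ 2 ^ i + k′
<-2^suc i k lt with k <? 2 ^ i
... | yes k<2^i = inj₁ k<2^i
... | no k≮2^i  = inj₂ (k ∸ 2 ^ i , +-cancelˡ-< (2 ^ i) _ _ (begin-strict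
      2 ^ i + (k ∸ 2 ^ i) ≡⟨ m+[n∸m]≡n 2^i≤k ⟩
      k                   <⟨ lt ⟩
      2 ^ i + (2 ^ i + 0) ≡⟨ cong (2 ^ i +_) (+-identityʳ (2 ^ i)) ⟩
      2 ^ i + 2 ^ i       ∎) , sym (m+[n∸m]≡n 2^i≤k))
  where open ≤-Reasoning
        2^i≤k : 2 ^ i ≤ k
        2^i≤k = ≮⇒≥ k≮2^i

n<2^n : ∀ n → n < 2 ^ n
n<2^n zero    = s≤s z≤n
n<2^n (suc n) = begin-strict
  suc n               ≤⟨ n<2^n n ⟩
  2 ^ n               <⟨ m<m+n (2 ^ n) (m^n>0 2 n) ⟩
  2 ^ n + 2 ^ n       ≡⟨ cong (2 ^ n +_) (+-identityʳ (2 ^ n)) ⟨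
  2 ^ suc n           ∎
  where open ≤-Reasoning

-- Weighted digit sums

sumBelow : (ℕ → ℕ) → ℕ → ℕ
sumBelow h zero    = 0
sumBelow h (suc i) = h 0 + sumBelow (h ∘ suc) i

sumBelow-suc : ∀ h i → sumBelow h (suc i) ≡ sumBelow h i + h i
sumBelow-suc h zero    = +-identityʳ (h 0)
sumBelow-suc h (suc i) = trans (cong (h 0 +_) (sumBelow-suc (h ∘ suc) i)) (sym (+-assoc (h 0) _ _))

digitSumByF : (ℕ → ℕ) → ℕ → ℕ → ℕ
digitSumByF h zero    n = 0
digitSumByF h (suc f) n = n % 2 * h 0 + digitSumByF (h ∘ suc) f (n / 2)

digitSumBy : (ℕ → ℕ) → ℕ → ℕ
digitSumBy h n = digitSumByF h n n

digitSumByF-zero : ∀ h f → digitSumByF h f 0 ≡ 0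
digitSumByF-zero h zero    = refl
digitSumByF-zero h (suc f) = digitSumByF-zero (h ∘ suc) f

[1+n]/2≤n : ∀ n → suc n / 2 ≤ n
[1+n]/2≤n n = ≤-pred (m/n<m (suc n) 2 ≤-refl)

digitSumByF-fuel : ∀ h {f f′} n → n ≤ f → n ≤ f′ → digitSumByF h f n ≡ digitSumByF h f′ n
digitSumByF-fuel h {f} {f′} zero _ _ = trans (digitSumByF-zero h f) (sym (digitSumByF-zero h f′))
digitSumByF-fuel h (suc n) (s≤s n≤f) (s≤s n≤f′) =
  cong (suc n % 2 * h 0 +_) (digitSumByF-fuel (h ∘ suc) (suc n / 2) (≤-trans ([1+n]/2≤n n) n≤f) (≤-trans ([1+n]/2≤n n) n≤f′))

digitSumBy-unfold : ∀ h n → digitSumBy h n ≡ n % 2 * h 0 + digitSumBy (h ∘ suc) (n / 2)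
digitSumBy-unfold h zero    = refl
digitSumBy-unfold h (suc n) = cong (suc n % 2 * h 0 +_) (digitSumByF-fuel (h ∘ suc) (suc n / 2) ([1+n]/2≤n n) ≤-refl)

digitSumBy-bit : ∀ h {b} m → Bit b → digitSumBy h (b + m * 2) ≡ b * h 0 + digitSumBy (h ∘ suc) m
digitSumBy-bit h {b} m b≤1 = trans (digitSumBy-unfold h (b + m * 2))
  (cong₂ (λ x y → x * h 0 + digitSumBy (h ∘ suc) y) (bit+double%2 m b≤1) (bit+double/2 m b≤1))

digitSumBy≤sumBelow : ∀ h i k → k < 2 ^ i → digitSumBy h k ≤ sumBelow h i
digitSumBy≤sumBelow h zero    zero    _        = z≤n
digitSumBy≤sumBelow h zero    (suc k) (s≤s ())
digitSumBy≤sumBelow h (suc i) k       k<2^i+1 with binary k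
... | b , m , b≤1 , refl rewrite digitSumBy-bit h m b≤1 =
  +-mono-≤ (bit*≤ b≤1) (digitSumBy≤sumBelow (h ∘ suc) i m (half-<-2^ m i b≤1 k<2^i+1))
  where bit*≤ : ∀ {b x} → Bit b → b * x ≤ x
        bit*≤ {zero}  _ = z≤n
        bit*≤ {suc zero} {x} _ = ≤-reflexive (+-identityʳ x)
        bit*≤ {suc (suc _)} (s≤s ())

digitSumBy-2^+ : ∀ h i k → k < 2 ^ i → digitSumBy h (2 ^ i + k) ≡ h i + digitSumBy h k
digitSumBy-2^+ h zero    zero    _ = +-identityʳ (h 0 + 0)
digitSumBy-2^+ h zero    (suc k) (s≤s ())
digitSumBy-2^+ h (suc i) k k<2^i+1 with binary k
... | b , m , b≤1 , refl = begin
    digitSumBy h (2 ^ suc i + (b + m * 2))    ≡⟨ cong (digitSumBy h) (regroup (2 ^ i) b m) ⟩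
    digitSumBy h (b + (2 ^ i + m) * 2)        ≡⟨ digitSumBy-bit h (2 ^ i + m) b≤1 ⟩
    b * h 0 + digitSumBy (h ∘ suc) (2 ^ i + m) ≡⟨ cong (b * h 0 +_) (digitSumBy-2^+ (h ∘ suc) i m (half-<-2^ m i b≤1 k<2^i+1)) ⟩
    b * h 0 + (h (suc i) + digitSumBy (h ∘ suc) m) ≡⟨ +-comm-middle (b * h 0) (h (suc i)) _ ⟩
    h (suc i) + (b * h 0 + digitSumBy (h ∘ suc) m) ≡⟨ cong (h (suc i) +_) (digitSumBy-bit h m b≤1) ⟨
    h (suc i) + digitSumBy h (b + m * 2)       ∎
  where
    open ≡-Reasoning
    regroup : ∀ (a b m : ℕ) → 2 * a + (b + m * 2) ≡ b + (a + m) * 2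
    regroup = solve-∀
    +-comm-middle : ∀ (x y z : ℕ) → x + (y + z) ≡ y + (x + z)
    +-comm-middle = solve-∀

Superincreasing : (ℕ → ℕ) → Set
Superincreasing h = ∀ j → sumBelow h j < h j

digitSumBy-<-suc : ∀ h → Superincreasing h → ∀ n → digitSumBy h n < digitSumBy h (suc n)
digitSumBy-<-suc h sup n = subst (_< digitSumBy h (suc n)) (+-identityʳ _)
  (step n h 0 sup n ≤-refl)
  where
  -- The offset c records the weights consumed by a carry.
  step : ∀ N h c → (∀ j → c + sumBelow h j < h j) → ∀ n → n ≤ N → digitSumBy h n + c < digitSumBy h (suc n)
  step N h c sup n n≤N with binary n
  ... | zero , m , _ , refl rewrite digitSumBy-bit h m (z≤n {1}) | digitSumBy-bit h {1} m ≤-refl = begin-strict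
      digitSumBy (h ∘ suc) m + c       <⟨ +-monoʳ-< _ (subst (_< h 0) (+-identityʳ c) (sup 0)) ⟩
      digitSumBy (h ∘ suc) m + h 0     ≡⟨ +-comm _ (h 0) ⟩
      h 0 + digitSumBy (h ∘ suc) m     ≡⟨ cong (_+ digitSumBy (h ∘ suc) m) (+-identityʳ (h 0)) ⟨
      (h 0 + 0) + digitSumBy (h ∘ suc) m ∎
    where open ≤-Reasoning
  step (suc N) h c sup n n≤N | suc zero , m , _ , refl rewrite digitSumBy-bit h {1} m ≤-refl | digitSumBy-bit h {0} (suc m) z≤n = begin-strict
      (h 0 + 0) + digitSumBy (h ∘ suc) m + c ≡⟨ regroup (h 0) _ c ⟩
      digitSumBy (h ∘ suc) m + (c + h 0)     <⟨ step N (h ∘ suc) (c + h 0) sup′ m m≤N ⟩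
      digitSumBy (h ∘ suc) (suc m)           ∎
    where
      open ≤-Reasoning
      regroup : ∀ (x y z : ℕ) → x + 0 + y + z ≡ y + (z + x)
      regroup = solve-∀
      sup′ : ∀ j → c + h 0 + sumBelow (h ∘ suc) j < h (suc j)
      sup′ j = subst (_< h (suc j)) (sym (+-assoc c (h 0) _)) (sup (suc j))
      m≤N : m ≤ N
      m≤N = ≤-trans (m≤m*n m 2) (≤-pred n≤N)
  step zero h c sup n () | suc zero , m , _ , refl
  step N h c sup n n≤N | suc (suc _) , m , s≤s () , _

module StrictlyIncreasing {f : ℕ → ℕ} (f-<-suc : ∀ n → f n < f (suc n)) where

  mono-< : ∀ {i j} → i < j → f i < f j
  mono-< {i} {suc j} (s≤s i≤j) with m≤n⇒m<n∨m≡n i≤j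
  ... | inj₁ i<j  = <-trans (mono-< i<j) (f-<-suc j)
  ... | inj₂ refl = f-<-suc j

  mono-≤ : ∀ {i j} → i ≤ j → f i ≤ f j
  mono-≤ i≤j with m≤n⇒m<n∨m≡n i≤j
  ... | inj₁ i<j  = <⇒≤ (mono-< i<j)
  ... | inj₂ refl = ≤-refl

  cancel-< : ∀ {i j} → f i < f j → i < j
  cancel-< {i} {j} fi<fj with <-cmp i j
  ... | tri< i<j _ _  = i<j
  ... | tri≈ _ refl _ = ⊥-elim (<-irrefl refl fi<fj)
  ... | tri> _ _ j<i  = ⊥-elim (<-asym fi<fj (mono-< j<i))

  n+f0≤f : ∀ n → n + f 0 ≤ f n
  n+f0≤f zero    = ≤-refl
  n+f0≤f (suc n) = ≤-trans (s≤s (n+f0≤f n)) (f-<-suc n)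

  n≤f : ∀ n → n ≤ f n
  n≤f n = ≤-trans (m≤m+n n (f 0)) (n+f0≤f n)

enumeration-≤ : ∀ {s s′ P} → Enumerates s P → Enumerates s′ P → ∀ k → s′ k ≤ s k
enumeration-≤ {s} {s′} (s-< , s-enum) (s′-< , s′-enum) k = begin
  s′ k           ≤⟨ S′.mono-≤ (StrictlyIncreasing.n≤f φ-<-suc k) ⟩
  s′ (φ k)       ≡⟨ proj₂ (index k) ⟩
  s k            ∎
  where
    open ≤-Reasoning
    module S′ = StrictlyIncreasing s′-<
    index : ∀ k → ∃ λ j → s′ j ≡ s k
    index k = Equivalence.to (s′-enum (s k)) (Equivalence.from (s-enum (s k)) (k , refl))
    φ : ℕ → ℕ
    φ k = proj₁ (index k)
    φ-<-suc : ∀ k → φ k < φ (suc k)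
    φ-<-suc k = S′.cancel-< (subst₂ _<_ (sym (proj₂ (index k))) (sym (proj₂ (index (suc k)))) (s-< k))

enumeration-unique : ∀ {s s′ P} → Enumerates s P → Enumerates s′ P → ∀ k → s k ≡ s′ k
enumeration-unique e e′ k = ≤-antisym (enumeration-≤ e′ e k) (enumeration-≤ e e′ k)

n≤digitSumBy : ∀ h → Superincreasing h → ∀ n → n ≤ digitSumBy h n
n≤digitSumBy h sup = StrictlyIncreasing.n≤f (digitSumBy-<-suc h sup)

weight≤digitSumBy : ∀ h → Superincreasing h → ∀ i k → 2 ^ i ≤ k → h i ≤ digitSumBy h k
weight≤digitSumBy h sup i k 2^i≤k = begin
  h i                      ≤⟨ m≤m+n (h i) 0 ⟩
  h i + digitSumBy h 0     ≡⟨ digitSumBy-2^+ h i 0 (m^n>0 2 i) ⟨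
  digitSumBy h (2 ^ i + 0) ≤⟨ StrictlyIncreasing.mono-≤ (digitSumBy-<-suc h sup) (≤-trans (≤-reflexive (+-identityʳ (2 ^ i))) 2^i≤k) ⟩
  digitSumBy h k           ∎
  where open ≤-Reasoning

-- Cameron's procedure

isSum-true⇔ : ∀ S m → isSum S m ≡ true ⇔ ∃₂ λ x y → x ∈ S × y ∈ S × x + y ≡ m
isSum-true⇔ S m with any? (λ x → any? (λ y → x + y ≟ m) S) S
... | yes p = mk⇔ (λ _ → decode p) (λ _ → refl)
  where decode : Any (λ x → Any (λ y → x + y ≡ m) S) S → ∃₂ λ x y → x ∈ S × y ∈ S × x + y ≡ m
        decode p with find p
        ... | x , x∈S , q with find q
        ...   | y , y∈S , e = x , y , x∈S , y∈S , e
... | no ¬p = mk⇔ (λ ()) (λ (x , y , x∈S , y∈S , e) → ⊥-elim (¬p (lose x∈S (lose y∈S e))))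

θstep : (ℕ → Bool) → ℕ → List ℕ × ℕ → List ℕ × ℕ
θstep w n (S , k) = if isSum S n then (S , k) else (if w k then (n ∷ S , suc k) else (S , suc k))

θstate-suc : ∀ w n → θstate w (suc n) ≡ θstep w (suc n) (θstate w n)
θstate-suc w n with θstate w n
... | S , k = refl

Lists : (ℕ → Set) → ℕ → List ℕ → Set
Lists P n S = ∀ x → x ∈ S ⇔ (x ≤ n × P x)

lists-skip : ∀ {P n S} → Lists P n S → ¬ P (suc n) → Lists P (suc n) S
lists-skip {P} {n} lists ¬p x = mk⇔
  (λ x∈S → map₁ m≤n⇒m≤1+n (Equivalence.to (lists x) x∈S))
  (λ (x≤ , px) → Equivalence.from (lists x) (≤-or-new x≤ px))
  where ≤-or-new : x ≤ suc n → P x → x ≤ n × P x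
        ≤-or-new x≤ px with m≤n⇒m<n∨m≡n x≤
        ... | inj₁ x<  = ≤-pred x< , px
        ... | inj₂ refl = ⊥-elim (¬p px)

lists-cons : ∀ {P n S} → Lists P n S → P (suc n) → Lists P (suc n) (suc n ∷ S)
lists-cons {P} {n} {S} lists p x = mk⇔ to from
  where to : x ∈ suc n ∷ S → x ≤ suc n × P x
        to (here refl)  = ≤-refl , p
        to (there x∈S) = map₁ m≤n⇒m≤1+n (Equivalence.to (lists x) x∈S)
        from : x ≤ suc n × P x → x ∈ suc n ∷ S
        from (x≤ , px) with m≤n⇒m<n∨m≡n x≤
        ... | inj₁ x<  = there (Equivalence.from (lists x) (≤-pred x< , px))
        ... | inj₂ refl = here refl

module Misses {P : ℕ → Set} (P? : ∀ n → Dec (P n)) where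

  misses : ℕ → ℕ
  misses zero    = 0
  misses (suc n) with P? (suc n)
  ... | yes _ = misses n
  ... | no  _ = suc (misses n)

  misses-hit : ∀ n → P (suc n) → misses (suc n) ≡ misses n
  misses-hit n p with P? (suc n)
  ... | yes _ = refl
  ... | no ¬p = ⊥-elim (¬p p)

  misses-miss : ∀ n → ¬ P (suc n) → misses (suc n) ≡ suc (misses n)
  misses-miss n ¬p with P? (suc n)
  ... | yes p = ⊥-elim (¬p p)
  ... | no _  = refl

  misses-≤-suc : ∀ n → misses n ≤ misses (suc n)
  misses-≤-suc n with P? (suc n)
  ... | yes _ = ≤-refl
  ... | no  _ = n≤1+n _

  misses-mono-≤ : ∀ {m n} → m ≤ n → misses m ≤ misses n
  misses-mono-≤ {m} {n} m≤n with m≤n⇒m<n∨m≡n m≤n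
  ... | inj₂ refl = ≤-refl
  misses-mono-≤ {m} {suc n} _ | inj₁ (s≤s m≤n) = ≤-trans (misses-mono-≤ m≤n) (misses-≤-suc n)

  misses-miss-injective : ∀ {m n} → ¬ P (suc m) → ¬ P (suc n) → misses m ≡ misses n → m ≡ n
  misses-miss-injective {m} {n} ¬pm ¬pn eq with <-cmp m n
  ... | tri< m<n _ _ = ⊥-elim (<-irrefl eq (≤-trans (≤-reflexive (sym (misses-miss m ¬pm))) (misses-mono-≤ m<n)))
  ... | tri≈ _ m≡n _ = m≡n
  ... | tri> _ _ n<m = ⊥-elim (<-irrefl (sym eq) (≤-trans (≤-reflexive (sym (misses-miss n ¬pn))) (misses-mono-≤ n<m)))

  misses-translate : ∀ a b → (∀ q → 0 < q → q ≤ b → P (a + q) ⇔ P q) → misses (a + b) ≡ misses a + misses b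
  misses-translate a zero    _ = trans (cong misses (+-identityʳ a)) (sym (+-identityʳ _))
  misses-translate a (suc b) shift rewrite +-suc a b with P? (suc (a + b)) | P? (suc b)
  ... | yes _  | yes _  = misses-translate a b (λ q 0<q q≤b → shift q 0<q (m≤n⇒m≤1+n q≤b))
  ... | no _   | no _   = trans (cong suc (misses-translate a b (λ q 0<q q≤b → shift q 0<q (m≤n⇒m≤1+n q≤b)))) (sym (+-suc _ _))
  ... | yes p  | no ¬p  = ⊥-elim (¬p (Equivalence.to (shift (suc b) (s≤s z≤n) ≤-refl) (subst P (sym (+-suc a b)) p)))
  ... | no ¬p  | yes p  = ⊥-elim (¬p (subst P (+-suc a b) (Equivalence.from (shift (suc b) (s≤s z≤n) ≤-refl) p)))

  misses-run : ∀ a b → (∀ q → 0 < q → q ≤ b → ¬ P (a + q)) → misses (a + b) ≡ misses a + b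
  misses-run a zero    _    = trans (cong misses (+-identityʳ a)) (sym (+-identityʳ _))
  misses-run a (suc b) none rewrite +-suc a b =
    trans (misses-miss (a + b) (λ p → none (suc b) (s≤s z≤n) ≤-refl (subst P (sym (+-suc a b)) p)))
          (trans (cong suc (misses-run a b (λ q 0<q q≤b → none q 0<q (m≤n⇒m≤1+n q≤b)))) (sym (+-suc _ b)))

-- Sparse weights

reach : (ℕ → ℕ) → ℕ → ℕ
reach g i = sumBelow g i + sumBelow g i + 2

Sparse : (ℕ → ℕ) → Set
Sparse g = ∀ i → reach g i ≤ g i

sparse⇒superincreasing : ∀ {g} → Sparse g → Superincreasing g
sparse⇒superincreasing {g} sparse j = <-≤-trans (≤-<-trans (m≤m+n _ _) (m<m+n _ (s≤s z≤n))) (sparse j)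

Tripling : (ℕ → ℕ) → Set
Tripling f = ∀ k → 3 * f k ≤ f (suc k)

tripling⇒twice-sumBelow : ∀ {f} → Tripling f → ∀ k → sumBelow f k + sumBelow f k + f 0 ≤ f k
tripling⇒twice-sumBelow {f} tripling zero    = ≤-refl
tripling⇒twice-sumBelow {f} tripling (suc k) = begin
  sumBelow f (suc k) + sumBelow f (suc k) + f 0     ≡⟨ cong (λ s → s + s + f 0) (sumBelow-suc f k) ⟩
  (sumBelow f k + f k) + (sumBelow f k + f k) + f 0 ≡⟨ regroup (sumBelow f k) (f k) (f 0) ⟩
  (sumBelow f k + sumBelow f k + f 0) + 2 * f k     ≤⟨ +-monoˡ-≤ (2 * f k) (tripling⇒twice-sumBelow tripling k) ⟩
  f k + 2 * f k                                      ≡⟨ regroup′ (f k) ⟩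
  3 * f k                                            ≤⟨ tripling k ⟩
  f (suc k)                                          ∎
  where
    open ≤-Reasoning
    regroup : ∀ (s x y : ℕ) → s + x + (s + x) + y ≡ s + s + y + 2 * x
    regroup = solve-∀
    regroup′ : ∀ (x : ℕ) → x + 2 * x ≡ 3 * x
    regroup′ = solve-∀

tripling⇒superincreasing : ∀ {f} → Tripling f → 1 ≤ f 0 → Superincreasing f
tripling⇒superincreasing {f} tripling 1≤f0 j = ≤-trans (≤-reflexive (+-comm 1 (sumBelow f j)))
  (≤-trans (+-mono-≤ (m≤m+n (sumBelow f j) (sumBelow f j)) 1≤f0) (tripling⇒twice-sumBelow tripling j))

tripling⇒sparse : ∀ {f} → Tripling f → 2 ≤ f 0 → Sparse f
tripling⇒sparse {f} tripling 2≤f0 i = ≤-trans (+-monoʳ-≤ _ 2≤f0) (tripling⇒twice-sumBelow tripling i)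

reach-suc : ∀ g i → reach g (suc i) ≡ 2 * g i + reach g i
reach-suc g i = trans (cong (λ s → s + s + 2) (sumBelow-suc g i)) (regroup (sumBelow g i) (g i))
  where regroup : ∀ (s x : ℕ) → s + x + (s + x) + 2 ≡ 2 * x + (s + s + 2)
        regroup = solve-∀

m<[1+n]*m+o : ∀ m n {o} → 0 < o → m < suc n * m + o
m<[1+n]*m+o m n 0<o = <-≤-trans (m<m+n m 0<o) (+-monoˡ-≤ _ (m≤m+n m (n * m)))

block-unique : ∀ G b b′ {x y} → 0 < x → x ≤ G → 0 < y → y ≤ G → b * G + x ≡ b′ * G + y → b ≡ b′ × x ≡ y
block-unique G zero    zero     _   _   _   _   eq = refl , eq
block-unique G zero    (suc b′) _   x≤G 0<y _   eq = ⊥-elim (<⇒≱ (m<[1+n]*m+o G b′ 0<y) (subst (_≤ G) eq x≤G))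
block-unique G (suc b) zero     0<x _   _   y≤G eq = ⊥-elim (<⇒≱ (m<[1+n]*m+o G b 0<x) (subst (_≤ G) (sym eq) y≤G))
block-unique G (suc b) (suc b′) 0<x x≤G 0<y y≤G eq with block-unique G b b′ 0<x x≤G 0<y y≤G
  (+-cancelˡ-≡ G _ _ (trans (sym (+-assoc G _ _)) (trans eq (+-assoc G _ _))))
... | refl , x≡y = refl , x≡y

module Cameron (d : ℕ → ℕ) (sparse : Sparse (λ i → 3 ^ i + d i)) where

  g : ℕ → ℕ
  g i = 3 ^ i + d i

  g-superincreasing : Superincreasing g
  g-superincreasing = sparse⇒superincreasing sparse

  PairSum : ℕ → Set
  PairSum n = ∃₂ λ k₁ k₂ → n ≡ 2 + digitSumBy g k₁ + digitSumBy g k₂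

  pairSum? : ∀ n → Dec (PairSum n)
  pairSum? n with anyUpTo? (λ k₁ → anyUpTo? (λ k₂ → n ≟ 2 + digitSumBy g k₁ + digitSumBy g k₂) n) n
  ... | yes (k₁ , _ , k₂ , _ , e) = yes (k₁ , k₂ , e)
  ... | no none = no λ { (k₁ , k₂ , refl) → none (k₁ , index< k₁ (s≤s (m≤n⇒m≤1+n (m≤m+n _ _))) ,
                                                  k₂ , index< k₂ (s≤s (m≤n⇒m≤1+n (m≤n+m _ _))) , refl) }
    where index< : ∀ k → digitSumBy g k < n → k < n
          index< k = ≤-<-trans (n≤digitSumBy g g-superincreasing k)

  open Misses pairSum? public

  PairSumBelow : ℕ → ℕ → Set
  PairSumBelow i q = ∃₂ λ k₁ k₂ → k₁ < 2 ^ i × k₂ < 2 ^ i × q ≡ 2 + digitSumBy g k₁ + digitSumBy g k₂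

  pairSumBelow-bounds : ∀ i {q} → PairSumBelow i q → 2 ≤ q × q ≤ reach g i
  pairSumBelow-bounds i (k₁ , k₂ , k₁< , k₂< , refl) = m≤m+n 2 _ ,
    ≤-trans (≤-reflexive (+-comm 2 _)) (+-monoˡ-≤ 2 (+-mono-≤ (digitSumBy≤sumBelow g i k₁ k₁<) (digitSumBy≤sumBelow g i k₂ k₂<)))

  digitSumBy-level : ∀ i k → digitSumBy g k < g (suc i) →
    ∃₂ λ c k′ → Bit c × k′ < 2 ^ i × digitSumBy g k ≡ c * g i + digitSumBy g k′
  digitSumBy-level i k small with k <? 2 ^ suc i
  ... | no k≮ = ⊥-elim (<⇒≱ small (weight≤digitSumBy g g-superincreasing (suc i) k (≮⇒≥ k≮)))
  ... | yes k< with <-2^suc i k k<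
  ...   | inj₁ k<2^i = 0 , k , z≤n , k<2^i , refl
  ...   | inj₂ (k′ , k′< , refl) = 1 , k′ , ≤-refl , k′< ,
            trans (digitSumBy-2^+ g i k′ k′<) (cong (_+ digitSumBy g k′) (sym (*-identityˡ (g i))))

  pairSum-blocks : ∀ i n → PairSum n → n ≤ reach g (suc i) →
    ∃₂ λ b q → b ≤ 2 × PairSumBelow i q × n ≡ b * g i + q
  pairSum-blocks i n (k₁ , k₂ , refl) n≤ with digitSumBy-level i k₁ (small (m≤m+n _ _)) | digitSumBy-level i k₂ (small (m≤n+m _ _))
    where small : ∀ {x} → x ≤ digitSumBy g k₁ + digitSumBy g k₂ → x < g (suc i)
          small x≤ = <-≤-trans (s≤s (≤-trans x≤ (n≤1+n _))) (≤-trans n≤ (sparse (suc i)))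
  ... | c₁ , k₁′ , c₁≤1 , k₁′< , e₁ | c₂ , k₂′ , c₂≤1 , k₂′< , e₂ =
    c₁ + c₂ , _ , +-mono-≤ c₁≤1 c₂≤1 , (k₁′ , k₂′ , k₁′< , k₂′< , refl) ,
    trans (cong₂ (λ x y → 2 + x + y) e₁ e₂) (regroup c₁ c₂ (g i) _ _)
    where regroup : ∀ (c₁ c₂ G x y : ℕ) → 2 + (c₁ * G + x) + (c₂ * G + y) ≡ (c₁ + c₂) * G + (2 + x + y)
          regroup = solve-∀

  pairSumBelow-shift : ∀ i b q → b ≤ 2 → PairSumBelow i q → PairSum (b * g i + q)
  pairSumBelow-shift i zero q _ (k₁ , k₂ , _ , _ , q≡) = k₁ , k₂ , q≡
  pairSumBelow-shift i (suc zero) q _ (k₁ , k₂ , k₁< , _ , refl) = 2 ^ i + k₁ , k₂ ,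
    trans (regroup (g i) _ _) (cong (λ x → 2 + x + digitSumBy g k₂) (sym (digitSumBy-2^+ g i k₁ k₁<)))
    where regroup : ∀ (G x y : ℕ) → (G + 0 * G) + (2 + x + y) ≡ 2 + (G + x) + y
          regroup = solve-∀
  pairSumBelow-shift i (suc (suc zero)) q _ (k₁ , k₂ , k₁< , k₂< , refl) = 2 ^ i + k₁ , 2 ^ i + k₂ ,
    trans (regroup (g i) _ _) (cong₂ (λ x y → 2 + x + y) (sym (digitSumBy-2^+ g i k₁ k₁<)) (sym (digitSumBy-2^+ g i k₂ k₂<)))
    where regroup : ∀ (G x y : ℕ) → (G + (G + 0 * G)) + (2 + x + y) ≡ 2 + (G + x) + (G + y)
          regroup = solve-∀
  pairSumBelow-shift i (suc (suc (suc _))) q (s≤s (s≤s ())) _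

  pairSumBelow-in-block : ∀ i {q} → PairSumBelow i q → 0 < q × q ≤ g i
  pairSumBelow-in-block i below with pairSumBelow-bounds i below
  ... | 2≤q , q≤reach = <-≤-trans (s≤s z≤n) 2≤q , ≤-trans q≤reach (sparse i)

  reach-≤-suc : ∀ i → reach g i ≤ reach g (suc i)
  reach-≤-suc i = ≤-trans (m≤n+m _ (2 * g i)) (≤-reflexive (sym (reach-suc g i)))

  pairSum-in-block : ∀ i b x → 0 < x → x ≤ g i → b * g i + x ≤ reach g (suc i) →
    PairSum (b * g i + x) → PairSumBelow i x
  pairSum-in-block i b x 0<x x≤g n≤ ps with pairSum-blocks i _ ps n≤
  ... | b′ , q , _ , below , eq with pairSumBelow-in-block i below
  ...   | 0<q , q≤g = subst (PairSumBelow i) (sym (proj₂ (block-unique (g i) b b′ 0<x x≤g 0<q q≤g eq))) below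

  pairSum-below : ∀ i q → q ≤ reach g i → PairSum q → PairSumBelow i q
  pairSum-below i q q≤reach ps@(_ , _ , refl) =
    pairSum-in-block i 0 q (s≤s z≤n) (≤-trans q≤reach (sparse i)) (≤-trans q≤reach (reach-≤-suc i)) ps

  pairSum-shift : ∀ i b q → b ≤ 2 → 0 < q → q ≤ reach g i → PairSum (b * g i + q) ⇔ PairSum q
  pairSum-shift i b q b≤2 0<q q≤reach = mk⇔
    (λ ps → pairSumBelow-shift i 0 q z≤n (pairSum-in-block i b q 0<q (≤-trans q≤reach (sparse i)) n≤ ps))
    (λ ps → pairSumBelow-shift i b q b≤2 (pairSum-below i q q≤reach ps))
    where n≤ : b * g i + q ≤ reach g (suc i)
          n≤ = ≤-trans (+-mono-≤ (*-monoˡ-≤ (g i) b≤2) q≤reach) (≤-reflexive (sym (reach-suc g i)))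

  pairSum-gap : ∀ i b r → b ≤ 1 → reach g i < r → r ≤ g i → ¬ PairSum (b * g i + r)
  pairSum-gap i b r b≤1 reach<r r≤g ps =
    <⇒≱ reach<r (proj₂ (pairSumBelow-bounds i (pairSum-in-block i b r (<-≤-trans (s≤s z≤n) reach<r) r≤g n≤ ps)))
    where n≤ : b * g i + r ≤ reach g (suc i)
          n≤ = begin
            b * g i + r        ≤⟨ +-mono-≤ (*-monoˡ-≤ (g i) b≤1) r≤g ⟩
            1 * g i + g i      ≡⟨ cong (_+ g i) (*-identityˡ (g i)) ⟩
            g i + g i          ≡⟨ cong (g i +_) (+-identityʳ (g i)) ⟨
            2 * g i            ≤⟨ m≤m+n _ _ ⟩
            2 * g i + reach g i ≡⟨ reach-suc g i ⟨
            reach g (suc i)    ∎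
            where open ≤-Reasoning

  misses-block : ∀ i b q → b ≤ 2 → q ≤ reach g i → misses (b * g i + q) ≡ misses (b * g i) + misses q
  misses-block i b q b≤2 q≤reach = misses-translate (b * g i) q
    (λ q′ 0<q′ q′≤q → pairSum-shift i b q′ b≤2 0<q′ (≤-trans q′≤q q≤reach))

  gap : ℕ → ℕ
  gap i = g i ∸ reach g i

  reach+gap : ∀ i → reach g i + gap i ≡ g i
  reach+gap i = m+[n∸m]≡n (sparse i)

  misses-gap : ∀ i b → b ≤ 1 → misses (suc b * g i) ≡ misses (b * g i + reach g i) + gap i
  misses-gap i b b≤1 = trans (cong misses blocks) (misses-run (b * g i + reach g i) (gap i) none)
    where
      blocks : suc b * g i ≡ b * g i + reach g i + gap i
      blocks = begin
        g i + b * g i               ≡⟨ +-comm (g i) (b * g i) ⟩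
        b * g i + g i               ≡⟨ cong (b * g i +_) (reach+gap i) ⟨
        b * g i + (reach g i + gap i) ≡⟨ +-assoc (b * g i) _ _ ⟨
        b * g i + reach g i + gap i ∎
        where open ≡-Reasoning
      none : ∀ q → 0 < q → q ≤ gap i → ¬ PairSum (b * g i + reach g i + q)
      none q 0<q q≤gap ps = pairSum-gap i b (reach g i + q) b≤1 (m<m+n _ 0<q)
        (≤-trans (+-monoʳ-≤ (reach g i) q≤gap) (≤-reflexive (reach+gap i))) (subst PairSum (+-assoc (b * g i) (reach g i) q) ps)

  misses-reach-suc : ∀ i → misses (reach g (suc i)) ≡ 3 * misses (reach g i) + 2 * gap i
  misses-reach-suc i = begin
    misses (reach g (suc i))             ≡⟨ cong misses (reach-suc g i) ⟩
    misses (2 * G + R)                   ≡⟨ misses-block i 2 R ≤-refl ≤-refl ⟩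
    misses (2 * G) + F                   ≡⟨ cong (_+ F) (misses-gap i 1 ≤-refl) ⟩
    misses (1 * G + R) + a + F           ≡⟨ cong (λ x → x + a + F) (misses-block i 1 R (s≤s z≤n) ≤-refl) ⟩
    misses (1 * G) + F + a + F           ≡⟨ cong (λ x → x + F + a + F) (misses-gap i 0 z≤n) ⟩
    F + a + F + a + F                    ≡⟨ regroup F a ⟩
    3 * F + 2 * a                        ∎
    where
      open ≡-Reasoning
      G R F a : ℕ
      G = g i
      R = reach g i
      F = misses R
      a = gap i
      regroup : ∀ (F a : ℕ) → F + a + F + a + F ≡ 3 * F + 2 * a
      regroup = solve-∀

  not-pairSum-1 : ¬ PairSum 1
  not-pairSum-1 (_ , _ , ())

  misses-reach : ∀ i → misses (reach g i) + 3 ^ i ≡ reach g i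
  misses-reach zero    = cong (_+ 1) (trans (misses-hit 1 (0 , 0 , refl)) (misses-miss 0 not-pairSum-1))
  misses-reach (suc i) = begin
    misses (reach g (suc i)) + 3 ^ suc i         ≡⟨ cong (_+ 3 ^ suc i) (misses-reach-suc i) ⟩
    3 * misses (reach g i) + 2 * gap i + 3 * 3 ^ i ≡⟨ regroup (misses (reach g i)) (gap i) (3 ^ i) ⟩
    3 * (misses (reach g i) + 3 ^ i) + 2 * gap i  ≡⟨ cong (λ x → 3 * x + 2 * gap i) (misses-reach i) ⟩
    3 * reach g i + 2 * gap i                     ≡⟨ regroup′ (reach g i) (gap i) ⟩
    2 * (reach g i + gap i) + reach g i           ≡⟨ cong (λ x → 2 * x + reach g i) (reach+gap i) ⟩
    2 * g i + reach g i                           ≡⟨ reach-suc g i ⟨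
    reach g (suc i)                               ∎
    where
      open ≡-Reasoning
      regroup : ∀ (F a P : ℕ) → 3 * F + 2 * a + 3 * P ≡ 3 * (F + P) + 2 * a
      regroup = solve-∀
      regroup′ : ∀ (R a : ℕ) → 3 * R + 2 * a ≡ 2 * (R + a) + R
      regroup′ = solve-∀

  misses-g : ∀ i → misses (g i) ≡ d i
  misses-g i = +-cancelˡ-≡ (3 ^ i) _ _ (begin
    3 ^ i + misses (g i)                    ≡⟨ cong (λ x → 3 ^ i + misses x) (*-identityˡ (g i)) ⟨
    3 ^ i + misses (1 * g i)                ≡⟨ cong (3 ^ i +_) (misses-gap i 0 z≤n) ⟩
    3 ^ i + (misses (reach g i) + gap i)    ≡⟨ regroup (3 ^ i) _ (gap i) ⟩
    misses (reach g i) + 3 ^ i + gap i      ≡⟨ cong (_+ gap i) (misses-reach i) ⟩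
    reach g i + gap i                       ≡⟨ reach+gap i ⟩
    g i                                     ∎)
    where
      open ≡-Reasoning
      regroup : ∀ (P F a : ℕ) → P + (F + a) ≡ F + P + a
      regroup = solve-∀

  suc-digitSumBy≤reach : ∀ i k → k < 2 ^ i → suc (digitSumBy g k) ≤ reach g i
  suc-digitSumBy≤reach i k k< = begin
    suc (digitSumBy g k)            ≤⟨ s≤s (digitSumBy≤sumBelow g i k k<) ⟩
    suc (sumBelow g i)              ≤⟨ +-monoʳ-≤ 1 (m≤n+m _ (sumBelow g i)) ⟩
    1 + (sumBelow g i + sumBelow g i) ≤⟨ ≤-reflexive (+-comm 1 _) ⟩
    sumBelow g i + sumBelow g i + 1 ≤⟨ +-monoʳ-≤ _ (n≤1+n 1) ⟩
    reach g i                       ∎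
    where open ≤-Reasoning

  digitSumBy-2^+-as-block : ∀ i k → k < 2 ^ i → ∀ x → x + digitSumBy g (2 ^ i + k) ≡ 1 * g i + (x + digitSumBy g k)
  digitSumBy-2^+-as-block i k k< x = begin
    x + digitSumBy g (2 ^ i + k)     ≡⟨ cong (x +_) (digitSumBy-2^+ g i k k<) ⟩
    x + (g i + digitSumBy g k)       ≡⟨ regroup x (g i) _ ⟩
    1 * g i + (x + digitSumBy g k)   ∎
    where
      open ≡-Reasoning
      regroup : ∀ (x G y : ℕ) → x + (G + y) ≡ 1 * G + (x + y)
      regroup = solve-∀

  misses-digitSumBy : ∀ k → misses (digitSumBy g k) ≡ digitSumBy d k
  misses-digitSumBy k = below k k (n<2^n k)
    where
    below : ∀ i k → k < 2 ^ i → misses (digitSumBy g k) ≡ digitSumBy d k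
    below zero    zero    _  = refl
    below zero    (suc k) (s≤s ())
    below (suc i) k       k< with <-2^suc i k k<
    ... | inj₁ k<2^i = below i k k<2^i
    ... | inj₂ (k′ , k′< , refl) = begin
      misses (digitSumBy g (2 ^ i + k′))          ≡⟨ cong misses (digitSumBy-2^+-as-block i k′ k′< 0) ⟩
      misses (1 * g i + digitSumBy g k′)          ≡⟨ misses-block i 1 _ (s≤s z≤n) (≤-trans (n≤1+n _) (suc-digitSumBy≤reach i k′ k′<)) ⟩
      misses (1 * g i) + misses (digitSumBy g k′) ≡⟨ cong₂ _+_ (trans (cong misses (*-identityˡ (g i))) (misses-g i)) (below i k′ k′<) ⟩
      d i + digitSumBy d k′                       ≡⟨ digitSumBy-2^+ d i k′ k′< ⟨
      digitSumBy d (2 ^ i + k′)                   ∎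
      where open ≡-Reasoning

  suc-digitSumBy-not-pairSum : ∀ k → ¬ PairSum (suc (digitSumBy g k))
  suc-digitSumBy-not-pairSum k = below k k (n<2^n k)
    where
    below : ∀ i k → k < 2 ^ i → ¬ PairSum (suc (digitSumBy g k))
    below zero    zero    _  = not-pairSum-1
    below zero    (suc k) (s≤s ())
    below (suc i) k       k< with <-2^suc i k k<
    ... | inj₁ k<2^i = below i k k<2^i
    ... | inj₂ (k′ , k′< , refl) = λ ps → below i k′ k′<
      (Equivalence.to (pairSum-shift i 1 (suc (digitSumBy g k′)) (s≤s z≤n) (s≤s z≤n) (suc-digitSumBy≤reach i k′ k′<))
        (subst PairSum (digitSumBy-2^+-as-block i k′ k′< 1) ps))

  module Theta (w : ℕ → Bool) (ones : ∀ n → w n ≡ true ⇔ ∃ λ k → n ≡ digitSumBy d k) where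

    A : ℕ → Set
    A x = ∃ λ k → x ≡ suc (digitSumBy g k)

    A⇒free∧reads-one : ∀ n → A (suc n) → ¬ PairSum (suc n) × w (misses n) ≡ true
    A⇒free∧reads-one n (k , refl) = suc-digitSumBy-not-pairSum k ,
      subst (λ x → w x ≡ true) (sym (misses-digitSumBy k)) (Equivalence.from (ones _) (k , refl))

    free∧reads-one⇒A : ∀ n → ¬ PairSum (suc n) → w (misses n) ≡ true → A (suc n)
    free∧reads-one⇒A n free one with Equivalence.to (ones (misses n)) one
    ... | k , eq = k , cong suc (misses-miss-injective free (suc-digitSumBy-not-pairSum k) (trans eq (sym (misses-digitSumBy k))))

    isSum⇔pairSum : ∀ {n S} → Lists A n S → isSum S (suc n) ≡ true ⇔ PairSum (suc n)
    isSum⇔pairSum {n} {S} lists = mk⇔ to from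
      where
        to : isSum S (suc n) ≡ true → PairSum (suc n)
        to sum with Equivalence.to (isSum-true⇔ S (suc n)) sum
        ... | x , y , x∈S , y∈S , x+y≡ with proj₂ (Equivalence.to (lists x) x∈S) | proj₂ (Equivalence.to (lists y) y∈S)
        ...   | k₁ , refl | k₂ , refl = k₁ , k₂ , trans (sym x+y≡) (cong suc (+-suc _ _))
        from : PairSum (suc n) → isSum S (suc n) ≡ true
        from (k₁ , k₂ , eq) = Equivalence.from (isSum-true⇔ S (suc n))
          (_ , _ , Equivalence.from (lists _) (x≤n , k₁ , refl) , Equivalence.from (lists _) (y≤n , k₂ , refl) ,
           trans (cong suc (+-suc _ _)) (sym eq))
          where x≤n : suc (digitSumBy g k₁) ≤ n
                x≤n = ≤-pred (≤-trans (s≤s (s≤s (m≤m+n _ _))) (≤-reflexive (sym eq)))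
                y≤n : suc (digitSumBy g k₂) ≤ n
                y≤n = ≤-pred (≤-trans (s≤s (s≤s (m≤n+m _ _))) (≤-reflexive (sym eq)))

    Invariant : ℕ → List ℕ × ℕ → Set
    Invariant n (S , k) = Lists A n S × k ≡ misses n

    invariant-step : ∀ n st → Invariant n st → Invariant (suc n) (θstep w (suc n) st)
    invariant-step n (S , k) (lists , refl) with isSum S (suc n) in sum
    ... | true  = lists-skip lists (λ a → proj₁ (A⇒free∧reads-one n a) ps) , sym (misses-hit n ps)
      where ps : PairSum (suc n)
            ps = Equivalence.to (isSum⇔pairSum lists) sum
    ... | false with w (misses n) in read
    ...   | true  = lists-cons lists (free∧reads-one⇒A n free read) , sym (misses-miss n free)
      where free : ¬ PairSum (suc n)
            free = not-¬ sum ∘ Equivalence.from (isSum⇔pairSum lists)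
    ...   | false = lists-skip lists (not-¬ read ∘ proj₂ ∘ A⇒free∧reads-one n) , sym (misses-miss n free)
      where free : ¬ PairSum (suc n)
            free = not-¬ sum ∘ Equivalence.from (isSum⇔pairSum lists)

    invariant : ∀ n → Invariant n (θstate w n)
    invariant zero    = (λ x → mk⇔ (λ ()) (λ { (z≤n , _ , ()) })) , refl
    invariant (suc n) = subst (Invariant (suc n)) (sym (θstate-suc w n)) (invariant-step n (θstate w n) (invariant n))

    ∈θ⇔A : ∀ x → x ∈θ w ⇔ A x
    ∈θ⇔A x with θstate w x | invariant x
    ... | S , _ | lists , _ = mk⇔ (proj₂ ∘ Equivalence.to (lists x)) (λ a → Equivalence.from (lists x) (≤-refl , a))

    θ-enumeration : Enumerates (suc ∘ digitSumBy g) (λ x → x ∈θ w)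
    θ-enumeration = (λ k → s≤s (digitSumBy-<-suc g g-superincreasing k)) ,
      λ x → mk⇔ (λ x∈ → map₂ sym (Equivalence.to (∈θ⇔A x) x∈))
                (λ (k , eq) → Equivalence.from (∈θ⇔A x) (k , sym eq))

-- The fixed point of σ

zeros : ℕ → List Bool
zeros n = replicate n false

zeros-+ : ∀ a b → zeros a ++ zeros b ≡ zeros (a + b)
zeros-+ zero    b = refl
zeros-+ (suc a) b = cong (false ∷_) (zeros-+ a b)

nth-zeros : ∀ a n → nth (zeros a) n ≡ false
nth-zeros zero    n       = refl
nth-zeros (suc a) zero    = refl
nth-zeros (suc a) (suc n) = nth-zeros a n

nth-≥length : ∀ (A : List Bool) n → length A ≤ n → nth A n ≡ false
nth-≥length []      n       _         = refl
nth-≥length (x ∷ A) (suc n) (s≤s A≤n) = nth-≥length A n A≤n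

nth-true⇒<length : ∀ (A : List Bool) n → nth A n ≡ true → n < length A
nth-true⇒<length A n one with n <? length A
... | yes n< = n<
... | no n≮ with trans (sym one) (nth-≥length A n (≮⇒≥ n≮))
...   | ()

nth-++ˡ : ∀ (A B : List Bool) n → n < length A → nth (A ++ B) n ≡ nth A n
nth-++ˡ (x ∷ A) B zero    _       = refl
nth-++ˡ (x ∷ A) B (suc n) (s≤s n<) = nth-++ˡ A B n n<

nth-++ʳ : ∀ (A B : List Bool) n → nth (A ++ B) (length A + n) ≡ nth B n
nth-++ʳ []      B n = refl
nth-++ʳ (x ∷ A) B n = nth-++ʳ A B n

nth-++-true⇔ : ∀ (A B : List Bool) n →
  nth (A ++ B) n ≡ true ⇔ (nth A n ≡ true ⊎ ∃ λ n′ → n ≡ length A + n′ × nth B n′ ≡ true)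
nth-++-true⇔ A B n = mk⇔ (to A n) from
  where
    to : ∀ A n → nth (A ++ B) n ≡ true → nth A n ≡ true ⊎ ∃ λ n′ → n ≡ length A + n′ × nth B n′ ≡ true
    to []      n       one = inj₂ (n , refl , one)
    to (x ∷ A) zero    one = inj₁ one
    to (x ∷ A) (suc n) one with to A n one
    ... | inj₁ one′              = inj₁ one′
    ... | inj₂ (n′ , refl , one′) = inj₂ (n′ , refl , one′)
    from : nth A n ≡ true ⊎ (∃ λ n′ → n ≡ length A + n′ × nth B n′ ≡ true) → nth (A ++ B) n ≡ true
    from (inj₁ one)              = trans (nth-++ˡ A B n (nth-true⇒<length A n one)) one
    from (inj₂ (n′ , refl , one)) = trans (nth-++ʳ A B n′) one

nth-padded-true⇔ : ∀ (A : List Bool) a n → nth (A ++ zeros a) n ≡ true ⇔ nth A n ≡ true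
nth-padded-true⇔ A a n = mk⇔ to (Equivalence.from (nth-++-true⇔ A (zeros a) n) ∘ inj₁)
  where to : nth (A ++ zeros a) n ≡ true → nth A n ≡ true
        to one with Equivalence.to (nth-++-true⇔ A (zeros a) n) one
        ... | inj₁ one′ = one′
        ... | inj₂ (n′ , _ , one′) with trans (sym one′) (nth-zeros a n′)
        ...   | ()

nth-padded-pair-true⇔ : ∀ (A B : List Bool) a b n → nth ((A ++ zeros a) ++ (B ++ zeros b)) n ≡ true ⇔
  (nth A n ≡ true ⊎ ∃ λ n′ → n ≡ length A + a + n′ × nth B n′ ≡ true)
nth-padded-pair-true⇔ A B a b n = mk⇔
  (Sum.map (Equivalence.to (nth-padded-true⇔ A a n)) (map₂ (map₂ (Equivalence.to (nth-padded-true⇔ B b _))) ∘ retarget)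
     ∘ Equivalence.to (nth-++-true⇔ (A ++ zeros a) _ n))
  (Equivalence.from (nth-++-true⇔ (A ++ zeros a) _ n)
     ∘ Sum.map (Equivalence.from (nth-padded-true⇔ A a n)) (map₂ (map₂ (Equivalence.from (nth-padded-true⇔ B b _))) ∘ retarget′))
  where
    length-A+a : length (A ++ zeros a) ≡ length A + a
    length-A+a = trans (length-++ A) (cong (length A +_) (length-replicate a))
    retarget : ∀ {Q : ℕ → Set} → (∃ λ n′ → n ≡ length (A ++ zeros a) + n′ × Q n′) → ∃ λ n′ → n ≡ length A + a + n′ × Q n′
    retarget (n′ , eq , q) = n′ , trans eq (cong (_+ n′) length-A+a) , q
    retarget′ : ∀ {Q : ℕ → Set} → (∃ λ n′ → n ≡ length A + a + n′ × Q n′) → ∃ λ n′ → n ≡ length (A ++ zeros a) + n′ × Q n′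
    retarget′ (n′ , eq , q) = n′ , trans eq (cong (_+ n′) (sym length-A+a)) , q

module Substitution (l₁ l₂ L : ℕ) where

  σ* : ℕ → List Bool → List Bool
  σ* zero    w = w
  σ* (suc K) w = concatMap (σ l₁ l₂ L) (σ* K w)

  σ^≡σ* : ∀ K → σ^ l₁ l₂ L K ≡ σ* K (true ∷ [])
  σ^≡σ* zero    = refl
  σ^≡σ* (suc K) = cong (concatMap (σ l₁ l₂ L)) (σ^≡σ* K)

  σ*-suc : ∀ K w → σ* (suc K) w ≡ σ* K (concatMap (σ l₁ l₂ L) w)
  σ*-suc zero    w = refl
  σ*-suc (suc K) w = cong (concatMap (σ l₁ l₂ L)) (σ*-suc K w)

  σ*-++ : ∀ K xs ys → σ* K (xs ++ ys) ≡ σ* K xs ++ σ* K ys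
  σ*-++ zero    xs ys = refl
  σ*-++ (suc K) xs ys = trans (cong (concatMap (σ l₁ l₂ L)) (σ*-++ K xs ys)) (concatMap-++ (σ l₁ l₂ L) (σ* K xs) (σ* K ys))

  σ-zeros : ∀ n → concatMap (σ l₁ l₂ L) (zeros n) ≡ zeros (L * n)
  σ-zeros zero    = cong zeros (sym (*-zeroʳ L))
  σ-zeros (suc n) = trans (cong (zeros L ++_) (σ-zeros n)) (trans (zeros-+ L (L * n)) (cong zeros (sym (*-suc L n))))

  σ*-zeros : ∀ K n → σ* K (zeros n) ≡ zeros (n * L ^ K)
  σ*-zeros zero    n = cong zeros (sym (*-identityʳ n))
  σ*-zeros (suc K) n = trans (cong (concatMap (σ l₁ l₂ L)) (σ*-zeros K n))
    (trans (σ-zeros (n * L ^ K)) (cong zeros (regroup L n (L ^ K))))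
    where regroup : ∀ (L n P : ℕ) → L * (n * P) ≡ n * (L * P)
          regroup = solve-∀

  -- σ^(K+1)(1) = σ^K(σ(1)), and σ^K maps 0^n to 0^(n L^K).
  σ^-suc : ∀ K → σ^ l₁ l₂ L (suc K) ≡ (σ^ l₁ l₂ L K ++ zeros (l₁ * L ^ K)) ++ (σ^ l₁ l₂ L K ++ zeros (l₂ * L ^ K))
  σ^-suc K = begin
    σ^ l₁ l₂ L (suc K)                                    ≡⟨ σ^≡σ* (suc K) ⟩
    σ* (suc K) one                                        ≡⟨ σ*-suc K one ⟩
    σ* K ((one ++ zeros l₁ ++ one ++ zeros l₂) ++ [])      ≡⟨ cong (σ* K) (++-identityʳ _) ⟩
    σ* K (one ++ zeros l₁ ++ one ++ zeros l₂)              ≡⟨ σ*-++ K one _ ⟩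
    σ* K one ++ σ* K (zeros l₁ ++ one ++ zeros l₂)         ≡⟨ cong (σ* K one ++_) (σ*-++ K (zeros l₁) _) ⟩
    σ* K one ++ σ* K (zeros l₁) ++ σ* K (one ++ zeros l₂)  ≡⟨ cong (λ z → σ* K one ++ σ* K (zeros l₁) ++ z) (σ*-++ K one (zeros l₂)) ⟩
    σ* K one ++ σ* K (zeros l₁) ++ σ* K one ++ σ* K (zeros l₂)
      ≡⟨ cong₂ (λ a b → σ* K one ++ a ++ σ* K one ++ b) (σ*-zeros K l₁) (σ*-zeros K l₂) ⟩
    σ* K one ++ zeros (l₁ * L ^ K) ++ σ* K one ++ zeros (l₂ * L ^ K)
      ≡⟨ ++-assoc (σ* K one) _ _ ⟨
    (σ* K one ++ zeros (l₁ * L ^ K)) ++ σ* K one ++ zeros (l₂ * L ^ K)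
      ≡⟨ cong (λ z → (z ++ zeros (l₁ * L ^ K)) ++ z ++ zeros (l₂ * L ^ K)) (σ^≡σ* K) ⟨
    (σ^ l₁ l₂ L K ++ zeros (l₁ * L ^ K)) ++ (σ^ l₁ l₂ L K ++ zeros (l₂ * L ^ K)) ∎
    where
      open ≡-Reasoning
      one : List Bool
      one = true ∷ []

  size : ℕ → ℕ
  size zero    = 1
  size (suc K) = size K + size K + (l₁ + l₂) * L ^ K

  offset : ℕ → ℕ
  offset K = size K + l₁ * L ^ K

  length-σ^ : ∀ K → length (σ^ l₁ l₂ L K) ≡ size K
  length-σ^ zero    = refl
  length-σ^ (suc K) rewrite σ^-suc K
    | length-++ (σ^ l₁ l₂ L K ++ zeros (l₁ * L ^ K)) {σ^ l₁ l₂ L K ++ zeros (l₂ * L ^ K)}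
    | length-++ (σ^ l₁ l₂ L K) {zeros (l₁ * L ^ K)} | length-++ (σ^ l₁ l₂ L K) {zeros (l₂ * L ^ K)}
    | length-replicate (l₁ * L ^ K) {false} | length-replicate (l₂ * L ^ K) {false} | length-σ^ K
    = regroup (size K) l₁ l₂ (L ^ K)
    where regroup : ∀ (s a b P : ℕ) → s + a * P + (s + b * P) ≡ s + s + (a + b) * P
          regroup = solve-∀

  σ^-suc-ones : ∀ K n → nth (σ^ l₁ l₂ L (suc K)) n ≡ true ⇔
    (nth (σ^ l₁ l₂ L K) n ≡ true ⊎ ∃ λ n′ → n ≡ offset K + n′ × nth (σ^ l₁ l₂ L K) n′ ≡ true)
  σ^-suc-ones K n = subst₂ (λ w m → nth w n ≡ true ⇔ (nth (σ^ l₁ l₂ L K) n ≡ true ⊎ ∃ λ n′ → n ≡ m + l₁ * L ^ K + n′ × nth (σ^ l₁ l₂ L K) n′ ≡ true))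
    (sym (σ^-suc K)) (length-σ^ K) (nth-padded-pair-true⇔ (σ^ l₁ l₂ L K) (σ^ l₁ l₂ L K) (l₁ * L ^ K) (l₂ * L ^ K) n)

  σ^-ones : ∀ K n → nth (σ^ l₁ l₂ L K) n ≡ true ⇔ ∃ λ k → k < 2 ^ K × n ≡ digitSumBy offset k
  σ^-ones zero n = mk⇔ (to n) from
    where to : ∀ n → nth (true ∷ []) n ≡ true → ∃ λ k → k < 1 × n ≡ digitSumBy offset k
          to zero _ = 0 , s≤s z≤n , refl
          from : (∃ λ k → k < 1 × n ≡ digitSumBy offset k) → nth (true ∷ []) n ≡ true
          from (zero , _ , refl) = refl
          from (suc _ , s≤s () , _)
  σ^-ones (suc K) n = mk⇔ to from
    where
      to : nth (σ^ l₁ l₂ L (suc K)) n ≡ true → ∃ λ k → k < 2 ^ suc K × n ≡ digitSumBy offset k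
      to one with Equivalence.to (σ^-suc-ones K n) one
      ... | inj₁ one′ with Equivalence.to (σ^-ones K n) one′
      ...   | k , k< , eq = k , ≤-trans k< (m≤m+n (2 ^ K) _) , eq
      to one | inj₂ (n′ , refl , one′) with Equivalence.to (σ^-ones K n′) one′
      ...   | k′ , k′< , refl = 2 ^ K + k′ , 2^K+k′<2^[1+K] , sym (digitSumBy-2^+ offset K k′ k′<)
        where 2^K+k′<2^[1+K] : 2 ^ K + k′ < 2 ^ suc K
              2^K+k′<2^[1+K] = subst (2 ^ K + k′ <_) (cong (2 ^ K +_) (sym (+-identityʳ (2 ^ K)))) (+-monoʳ-< (2 ^ K) k′<)
      from : (∃ λ k → k < 2 ^ suc K × n ≡ digitSumBy offset k) → nth (σ^ l₁ l₂ L (suc K)) n ≡ true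
      from (k , k< , refl) with <-2^suc K k k<
      ... | inj₁ k<2^K = Equivalence.from (σ^-suc-ones K _) (inj₁ (Equivalence.from (σ^-ones K _) (k , k<2^K , refl)))
      ... | inj₂ (k′ , k′< , refl) = Equivalence.from (σ^-suc-ones K _)
              (inj₂ (_ , digitSumBy-2^+ offset K k′ k′< , Equivalence.from (σ^-ones K _) (k′ , k′< , refl)))

  σ∞-ones : Superincreasing offset → ∀ n → σ∞ l₁ l₂ L n ≡ true ⇔ ∃ λ k → n ≡ digitSumBy offset k
  σ∞-ones sup n = mk⇔
    (map₂ proj₂ ∘ Equivalence.to (σ^-ones (suc n) n))
    (λ (k , eq) → Equivalence.from (σ^-ones (suc n) n) (k , k<2^[1+n] k eq , eq))
    where k<2^[1+n] : ∀ k → n ≡ digitSumBy offset k → k < 2 ^ suc n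
          k<2^[1+n] k refl = ≤-<-trans (m≤n⇒m≤1+n (n≤digitSumBy offset sup k)) (n<2^n _)

-- Parity

infix 4 _≡₂_
record _≡₂_ (a b : ℕ) : Set where
  constructor same-parity
  field %2-≡ : a % 2 ≡ b % 2
open _≡₂_

≡₂-refl : ∀ {a} → a ≡₂ a
≡₂-refl = same-parity refl

≡₂-trans : ∀ {a b c} → a ≡₂ b → b ≡₂ c → a ≡₂ c
≡₂-trans (same-parity p) (same-parity q) = same-parity (trans p q)

≡₂-setoid : Setoid 0ℓ 0ℓ
≡₂-setoid = record
  { Carrier = ℕ
  ; _≈_ = _≡₂_
  ; isEquivalence = record
    { refl  = ≡₂-refl
    ; sym   = λ (same-parity p) → same-parity (sym p)
    ; trans = ≡₂-trans
    }
  }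

≡⇒≡₂ : ∀ {a b} → a ≡ b → a ≡₂ b
≡⇒≡₂ refl = same-parity refl

+-cong₂ : ∀ {a a′ b b′} → a ≡₂ a′ → b ≡₂ b′ → a + b ≡₂ a′ + b′
+-cong₂ {a} {a′} {b} {b′} (same-parity p) (same-parity q) =
  same-parity (trans (%-distribˡ-+ a b 2) (trans (cong₂ (λ x y → (x + y) % 2) p q) (sym (%-distribˡ-+ a′ b′ 2))))

*-cong₂ : ∀ {a a′ b b′} → a ≡₂ a′ → b ≡₂ b′ → a * b ≡₂ a′ * b′
*-cong₂ {a} {a′} {b} {b′} (same-parity p) (same-parity q) =
  same-parity (trans (%-distribˡ-* a b 2) (trans (cong₂ (λ x y → (x * y) % 2) p q) (sym (%-distribˡ-* a′ b′ 2))))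

+-double≡₂ : ∀ a b → a + b * 2 ≡₂ a
+-double≡₂ a b = same-parity ([m+kn]%n≡m%n a b 2)

%2≡₂ : ∀ a → a % 2 ≡₂ a
%2≡₂ a = same-parity (m%n%n≡m%n a 2)

%2≡0⊎1 : ∀ a → a % 2 ≡ 0 ⊎ a % 2 ≡ 1
%2≡0⊎1 a with a % 2 | m%n<n a 2
... | zero        | _ = inj₁ refl
... | suc zero    | _ = inj₂ refl
... | suc (suc _) | s≤s (s≤s ())

square≡₂ : ∀ a → a * a ≡₂ a
square≡₂ a = begin
  a * a             ≈⟨ *-cong₂ (%2≡₂ a) (%2≡₂ a) ⟨
  a % 2 * (a % 2)   ≈⟨ ≡⇒≡₂ (idempotent (a % 2) (%2≡0⊎1 a)) ⟩
  a % 2             ≈⟨ %2≡₂ a ⟩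
  a                 ∎
  where
    open ≈-Reasoning ≡₂-setoid
    idempotent : ∀ b → b ≡ 0 ⊎ b ≡ 1 → b * b ≡ b
    idempotent _ (inj₁ refl) = refl
    idempotent _ (inj₂ refl) = refl

3^≡₂1 : ∀ k → 3 ^ k ≡₂ 1
3^≡₂1 zero    = same-parity refl
3^≡₂1 (suc k) = ≡₂-trans (*-cong₂ (≡₂-refl {3}) (3^≡₂1 k)) (same-parity refl)

^-suc≡₂ : ∀ a k → a ^ suc k ≡₂ a
^-suc≡₂ a zero    = ≡⇒≡₂ (*-identityʳ a)
^-suc≡₂ a (suc k) = ≡₂-trans (*-cong₂ (≡₂-refl {a}) (^-suc≡₂ a k)) (square≡₂ a)

digitSumBy≡₂ : ∀ h e → (∀ i → h i ≡₂ e) → ∀ n → digitSumBy h n ≡₂ digitSum n * e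
digitSumBy≡₂ h e h≡₂e n = withFuel h h≡₂e n n
  where
    withFuel : ∀ h → (∀ i → h i ≡₂ e) → ∀ f n → digitSumByF h f n ≡₂ digitSumF f n * e
    withFuel h h≡₂e zero    n = same-parity refl
    withFuel h h≡₂e (suc f) n = ≡₂-trans
      (+-cong₂ (*-cong₂ (≡₂-refl {n % 2}) (h≡₂e 0)) (withFuel (h ∘ suc) (h≡₂e ∘ suc) f (n / 2)))
      (≡⇒≡₂ (sym (*-distribʳ-+ e (n % 2) (digitSumF f (n / 2)))))

periodic⊎thueMorse : ∀ (x : ℕ → ℕ) c e → (∀ n → x n ≡₂ c + digitSum n * e) →
  Periodic (λ n → x n % 2) ⊎ ThueMorseUpToCoding (λ n → x n % 2)
periodic⊎thueMorse x c e x≡₂ with %2≡0⊎1 e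
... | inj₁ even = inj₁ (1 , s≤s z≤n , λ n → trans (constant (n + 1)) (sym (constant n)))
  where constant : ∀ n → x n % 2 ≡ c % 2
        constant n = %2-≡ (begin
          x n                  ≈⟨ x≡₂ n ⟩
          c + digitSum n * e   ≈⟨ +-cong₂ (≡₂-refl {c}) (*-cong₂ (≡₂-refl {digitSum n}) (same-parity even)) ⟩
          c + digitSum n * 0   ≡⟨ trans (cong (c +_) (*-zeroʳ (digitSum n))) (+-identityʳ c) ⟩
          c                    ∎)
          where open ≈-Reasoning ≡₂-setoid
... | inj₂ odd = inj₂ ((λ t → (c + t) % 2) , ≤-pred (m%n<n (c + 0) 2) , ≤-pred (m%n<n (c + 1) 2) , coded)
  where coded : ∀ n → x n % 2 ≡ (c + thueMorse n) % 2
        coded n = %2-≡ (begin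
          x n                  ≈⟨ x≡₂ n ⟩
          c + digitSum n * e   ≈⟨ +-cong₂ (≡₂-refl {c}) (*-cong₂ (≡₂-refl {digitSum n}) (same-parity odd)) ⟩
          c + digitSum n * 1   ≡⟨ cong (c +_) (*-identityʳ (digitSum n)) ⟩
          c + digitSum n       ≈⟨ +-cong₂ (≡₂-refl {c}) (%2≡₂ (digitSum n)) ⟨
          c + thueMorse n      ∎)
          where open ≈-Reasoning ≡₂-setoid

module Weights (l₁ l₂ m : ℕ) (nontrivial : 1 ≤ l₁ + l₂) where

  open Substitution l₁ l₂ (3 + m) public

  -- σ^K(1) has length at most c·L^K for L = 3 + m and c = l₁(L − 2) + l₂.
  c : ℕ
  c = l₁ * suc m + l₂

  l₁+l₂≤c : l₁ + l₂ ≤ c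
  l₁+l₂≤c = +-monoˡ-≤ l₂ (≤-trans (≤-reflexive (sym (*-identityʳ l₁))) (*-monoʳ-≤ l₁ (s≤s z≤n)))

  size≤ : ∀ K → size K ≤ c * (3 + m) ^ K
  size≤ zero    = ≤-trans nontrivial (≤-trans l₁+l₂≤c (≤-reflexive (sym (*-identityʳ c))))
  size≤ (suc K) = begin
    size K + size K + (l₁ + l₂) * P ≤⟨ +-mono-≤ (+-mono-≤ (size≤ K) (size≤ K)) (*-monoˡ-≤ P l₁+l₂≤c) ⟩
    c * P + c * P + c * P           ≡⟨ regroup c P ⟩
    c * (3 * P)                     ≤⟨ *-monoʳ-≤ c (*-monoˡ-≤ P (m≤m+n 3 m)) ⟩
    c * ((3 + m) * P)               ∎
    where
      open ≤-Reasoning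
      P : ℕ
      P = (3 + m) ^ K
      regroup : ∀ (c P : ℕ) → c * P + c * P + c * P ≡ c * (3 * P)
      regroup = solve-∀

  offset-tripling : Tripling offset
  offset-tripling K = begin
    3 * (size K + l₁ * P)                                       ≡⟨ regroup (size K) (l₁ * P) ⟩
    size K + size K + size K + 3 * (l₁ * P)                     ≤⟨ +-monoˡ-≤ _ (+-monoʳ-≤ (size K + size K) (size≤ K)) ⟩
    size K + size K + (l₁ * suc m + l₂) * P + 3 * (l₁ * P)      ≡⟨ regroup′ (size K) l₁ l₂ m P ⟩
    size K + size K + (l₁ + l₂) * P + l₁ * ((3 + m) * P)        ∎
    where
      open ≤-Reasoning
      P : ℕ
      P = (3 + m) ^ K
      regroup : ∀ (s x : ℕ) → 3 * (s + x) ≡ s + s + s + 3 * x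
      regroup = solve-∀
      regroup′ : ∀ (s a b m P : ℕ) → s + s + (a * suc m + b) * P + 3 * (a * P) ≡ s + s + (a + b) * P + a * ((3 + m) * P)
      regroup′ = solve-∀

  weight-tripling : Tripling (λ i → 3 ^ i + offset i)
  weight-tripling K = ≤-trans (≤-reflexive (*-distribˡ-+ 3 (3 ^ K) (offset K))) (+-monoʳ-≤ (3 * 3 ^ K) (offset-tripling K))

  offset-superincreasing : Superincreasing offset
  offset-superincreasing = tripling⇒superincreasing offset-tripling (s≤s z≤n)

  weights-sparse : Sparse (λ i → 3 ^ i + offset i)
  weights-sparse = tripling⇒sparse weight-tripling (s≤s (s≤s z≤n))

  weight-parity : ∀ i → 3 ^ (2 + i) + offset (2 + i) ≡₂ 1 + l₂ * (3 + m)
  weight-parity i = begin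
    3 ^ (2 + i) + (size (2 + i) + l₁ * L ^ (2 + i))   ≈⟨ +-cong₂ (3^≡₂1 (2 + i)) (+-cong₂ size≡₂ (*-cong₂ (≡₂-refl {l₁}) (^-suc≡₂ L (suc i)))) ⟩
    1 + ((l₁ + l₂) * L + l₁ * L)                       ≡⟨ regroup l₁ l₂ L ⟩
    1 + l₂ * L + l₁ * L * 2                            ≈⟨ +-double≡₂ (1 + l₂ * L) (l₁ * L) ⟩
    1 + l₂ * L                                         ∎
    where
      open ≈-Reasoning ≡₂-setoid
      L : ℕ
      L = 3 + m
      size≡₂ : size (2 + i) ≡₂ (l₁ + l₂) * L
      size≡₂ = begin
        size (suc i) + size (suc i) + (l₁ + l₂) * L ^ suc i ≡⟨ regroup′ (size (suc i)) _ ⟩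
        (l₁ + l₂) * L ^ suc i + size (suc i) * 2           ≈⟨ +-double≡₂ _ (size (suc i)) ⟩
        (l₁ + l₂) * L ^ suc i                              ≈⟨ *-cong₂ (≡₂-refl {l₁ + l₂}) (^-suc≡₂ L i) ⟩
        (l₁ + l₂) * L                                      ∎
        where regroup′ : ∀ (s x : ℕ) → s + s + x ≡ x + s * 2
              regroup′ = solve-∀
      regroup : ∀ (a b L : ℕ) → 1 + ((a + b) * L + a * L) ≡ 1 + b * L + a * L * 2
      regroup = solve-∀

module Subsequences (l₁ l₂ m : ℕ) (nontrivial : 1 ≤ l₁ + l₂) (s : ℕ → ℕ)
                    (enum : Enumerates s (λ x → x ∈θ σ∞ l₁ l₂ (3 + m))) where

  open Weights l₁ l₂ m nontrivial
  open Cameron offset weights-sparse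
  open Theta (σ∞ l₁ l₂ (3 + m)) (σ∞-ones offset-superincreasing)

  s≡ : ∀ k → s k ≡ suc (digitSumBy g k)
  s≡ = enumeration-unique enum θ-enumeration

  s-4n+j : ∀ {b₀ b₁} → Bit b₀ → Bit b₁ → ∀ n →
    s (4 * n + (b₀ + b₁ * 2)) ≡ suc (b₀ * g 0 + b₁ * g 1) + digitSumBy (g ∘ suc ∘ suc) n
  s-4n+j {b₀} {b₁} b₀≤1 b₁≤1 n = begin
    s (4 * n + (b₀ + b₁ * 2))                                  ≡⟨ s≡ _ ⟩
    suc (digitSumBy g (4 * n + (b₀ + b₁ * 2)))                 ≡⟨ cong (suc ∘ digitSumBy g) (regroup n b₀ b₁) ⟩
    suc (digitSumBy g (b₀ + (b₁ + n * 2) * 2))                 ≡⟨ cong suc (digitSumBy-bit g (b₁ + n * 2) b₀≤1) ⟩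
    suc (b₀ * g 0 + digitSumBy (g ∘ suc) (b₁ + n * 2))         ≡⟨ cong (λ x → suc (b₀ * g 0 + x)) (digitSumBy-bit (g ∘ suc) n b₁≤1) ⟩
    suc (b₀ * g 0 + (b₁ * g 1 + digitSumBy (g ∘ suc ∘ suc) n)) ≡⟨ cong suc (+-assoc (b₀ * g 0) _ _) ⟨
    suc (b₀ * g 0 + b₁ * g 1) + digitSumBy (g ∘ suc ∘ suc) n   ∎
    where
      open ≡-Reasoning
      regroup : ∀ (n a b : ℕ) → 4 * n + (a + b * 2) ≡ a + (b + n * 2) * 2
      regroup = solve-∀

  subsequence : ∀ {b₀ b₁} → Bit b₀ → Bit b₁ →
    Periodic (λ n → s (4 * n + (b₀ + b₁ * 2)) % 2) ⊎ ThueMorseUpToCoding (λ n → s (4 * n + (b₀ + b₁ * 2)) % 2)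
  subsequence {b₀} {b₁} b₀≤1 b₁≤1 = periodic⊎thueMorse (λ n → s (4 * n + (b₀ + b₁ * 2))) (suc (b₀ * g 0 + b₁ * g 1)) (1 + l₂ * (3 + m))
    λ n → ≡₂-trans (≡⇒≡₂ (s-4n+j b₀≤1 b₁≤1 n))
            (+-cong₂ ≡₂-refl (digitSumBy≡₂ (g ∘ suc ∘ suc) _ weight-parity n))

j≤3⇒bits : ∀ {j} → j ≤ 3 → ∃₂ λ b₀ b₁ → Bit b₀ × Bit b₁ × j ≡ b₀ + b₁ * 2
j≤3⇒bits {0} _ = 0 , 0 , z≤n , z≤n , refl
j≤3⇒bits {1} _ = 1 , 0 , ≤-refl , z≤n , refl
j≤3⇒bits {2} _ = 0 , 1 , z≤n , ≤-refl , refl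
j≤3⇒bits {3} _ = 1 , 1 , ≤-refl , ≤-refl , refl
j≤3⇒bits {suc (suc (suc (suc _)))} (s≤s (s≤s (s≤s ())))

l₁+l₂-positive : ∀ l₁ l₂ L → 3 < l₁ * L + l₂ → 1 ≤ l₁ + l₂
l₁+l₂-positive zero    zero    L ()
l₁+l₂-positive zero    (suc _) L _ = s≤s z≤n
l₁+l₂-positive (suc _) _       L _ = s≤s z≤n

mainTheorem8 : (l₁ l₂ l₃ : ℕ) → 3 ≤ l₃ → 4 * (l₁ + l₂) + 17 ≤ 7 * l₃ → 3 < l₁ * (l₃ ∸ 1) + l₂ → (s : ℕ → ℕ) → Enumerates s (λ m → m ∈θ σ∞ l₁ l₂ l₃) → (j : ℕ) → j ≤ 3 → Periodic (λ n → s (4 * n + j) % 2) ⊎ ThueMorseUpToCoding (λ n → s (4 * n + j) % 2)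
mainTheorem8 l₁ l₂ (suc (suc (suc m))) _ _ 3< s enum j j≤3 with j≤3⇒bits j≤3
... | b₀ , b₁ , b₀≤1 , b₁≤1 , refl = Subsequences.subsequence l₁ l₂ m (l₁+l₂-positive l₁ l₂ _ 3<) s enum b₀≤1 b₁≤1
mainTheorem8 l₁ l₂ (suc (suc zero)) (s≤s (s≤s ())) _ _ _ _ _ _
mainTheorem8 l₁ l₂ (suc zero)       (s≤s ())       _ _ _ _ _ _
mainTheorem8 l₁ l₂ zero             ()             _ _ _ _ _ _
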